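{- Let $p_1,\dots,p_n$ be points in a metric space $(V,\mathrm{dist})$ and for $t\in\{1,\dots,n\}$ let $Q_t:=\sum_{i=1}^t\sum_{j=1}^t\mathrm{dist}(p_i,p_j)$. Assume $Q_n>0$. For any $t$, if $Q_t=0$, then \[\frac1t\ \ge\ \frac{\sum_{i=1}^n\mathrm{dist}(p_t,p_i)}{Q_n}.\] -}

module Defs where

open import Level using (0ℓ) renaming (suc to lsuc)
open import Data.Nat using (ℕ; zero; suc)
open import Data.Fin using (Fin; zero; suc)
open import Data.Product using (∃; _×_)
open import Relation.Nullary using (¬_)
open import Relation.Binary.Core using (Rel)
open import Relation.Binary.Structures using (IsTotalOrder)
open import Algebra.Core using (Op₁; Op₂)
open import Algebra.Structures using (IsCommutativeRing)

-- Since agda-stdlib has no real numbers, we axiomatise them: a model of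
-- the real numbers is a complete (Dedekind/sup-complete) totally ordered
-- field.
record RealField : Set₁ where
  infixl 7 _*_
  infixl 6 _+_
  infix  4 _≈_ _≤_
  field
    Carrier : Set
    _≈_     : Rel Carrier 0ℓ
    _≤_     : Rel Carrier 0ℓ
    _+_ _*_ : Op₂ Carrier
    -_      : Op₁ Carrier
    _⁻¹     : Op₁ Carrier
    0# 1#   : Carrier
    isCommutativeRing : IsCommutativeRing _≈_ _+_ _*_ -_ 0# 1#
    0≉1        : ¬ (0# ≈ 1#)
    ⁻¹-cong    : ∀ {x y} → x ≈ y → (x ⁻¹) ≈ (y ⁻¹)
    ⁻¹-inverse : ∀ x → ¬ (x ≈ 0#) → x * (x ⁻¹) ≈ 1#
    isTotalOrder : IsTotalOrder _≈_ _≤_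
    +-monoˡ-≤  : ∀ {x y} z → x ≤ y → x + z ≤ y + z
    *-nonneg   : ∀ {x y} → 0# ≤ x → 0# ≤ y → 0# ≤ x * y
    complete   : (P : Carrier → Set) → ∃ P → ∃ (λ b → ∀ x → P x → x ≤ b) →
                 ∃ (λ s → (∀ x → P x → x ≤ s) ×
                          (∀ b → (∀ x → P x → x ≤ b) → s ≤ b))

module RealOps (R : RealField) where
  open RealField R public

  infixl 7 _/_
  infix  4 _<_

  _<_ : Rel Carrier 0ℓ
  x < y = (x ≤ y) × ¬ (x ≈ y)

  _/_ : Op₂ Carrier
  x / y = x * (y ⁻¹)

  fromℕ : ℕ → Carrier
  fromℕ zero    = 0#
  fromℕ (suc n) = 1# + fromℕ n

  ∑ : ∀ {n} → (Fin n → Carrier) → Carrier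
  ∑ {zero}  f = 0#
  ∑ {suc n} f = f zero + ∑ (λ i → f (suc i))

  ∑< : ∀ {n} → ℕ → (Fin n → Carrier) → Carrier
  ∑< {zero}  k       f = 0#
  ∑< {suc n} zero    f = 0#
  ∑< {suc n} (suc k) f = f zero + ∑< k (λ i → f (suc i))

  -- Q k = ∑_{i=1}^{k} ∑_{j=1}^{k} dist(p_i, p_j)   (points indexed by Fin n,
  -- so paper's p_i is p (i-1))
  Q : {V : Set} (dist : V → V → Carrier) {n : ℕ} (p : Fin n → V) → ℕ → Carrier
  Q dist p k = ∑< k (λ i → ∑< k (λ j → dist (p i) (p j)))

-- Every term of Q_t = Σ_{i,j ≤ t} dist(p_i, p_j) is non-negative, so Q_t = 0 forces
-- p_1 = … = p_t.  Hence the first t rows of the distance matrix all equal the row of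
-- p_t, and Q_n, the sum of all n non-negative rows, is at least t · Σ_i dist(p_t, p_i).
module Submission where

open import Defs
open import Data.Nat using (ℕ; zero; suc; s≤s; z≤n) renaming (_<_ to _<ℕ_; _≤_ to _≤ℕ_)
open import Data.Nat.Properties using (n<1+n)
open import Data.Fin using (Fin; toℕ) renaming (zero to fzero; suc to fsuc)
open import Data.Fin.Properties using (toℕ<n)
open import Data.Product using (_,_)
open import Data.Sum using (inj₁; inj₂)
open import Data.Empty using (⊥-elim)
open import Relation.Nullary using (¬_)
open import Relation.Binary.PropositionalEquality as ≡ using (_≡_)
open import Relation.Binary.Bundles using (Poset)
open import Relation.Binary.Structures using (IsTotalOrder)
open import Algebra.Bundles using (CommutativeRing)
open import Function.Metric.Structures using (IsQuasiSemiMetric; IsGeneralMetric)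
import Algebra.Properties.Ring as RingProperties
import Algebra.Properties.Group as GroupProperties
import Algebra.Properties.CommutativeSemigroup as CommutativeSemigroupProperties
import Relation.Binary.Reasoning.PartialOrder as PosetReasoning

module OrderedFieldProperties (R : RealField) where
  open RealOps R
  open IsTotalOrder isTotalOrder using (isPartialOrder; total; antisym; ≤-respˡ-≈; ≤-respʳ-≈)
    renaming (refl to ≤-refl; trans to ≤-trans)

  commutativeRing : CommutativeRing _ _
  commutativeRing = record { isCommutativeRing = isCommutativeRing }

  open CommutativeRing commutativeRing public
    using (_-_; +-comm; +-identityˡ; +-identityʳ; -‿inverseʳ;
           *-cong; *-comm; *-assoc; *-identityˡ; *-identityʳ; distribʳ; zeroˡ;
           +-cong; +-group; *-commutativeSemigroup)
    renaming (refl to ≈-refl; sym to ≈-sym; trans to ≈-trans; reflexive to ≈-reflexive)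
  open RingProperties (CommutativeRing.ring commutativeRing) using (-1*x≈-x; [y-z]x≈yx-zx)
  open GroupProperties +-group using (⁻¹-involutive; //-rightDividesˡ)
  open CommutativeSemigroupProperties *-commutativeSemigroup using (interchange)

  poset : Poset _ _ _
  poset = record { isPartialOrder = isPartialOrder }

  open PosetReasoning poset

  +-monoʳ-≤ : ∀ z {x y} → x ≤ y → z + x ≤ z + y
  +-monoʳ-≤ z {x} {y} x≤y = begin
    z + x  ≈⟨ +-comm z x ⟩
    x + z  ≤⟨ +-monoˡ-≤ z x≤y ⟩
    y + z  ≈⟨ +-comm y z ⟩
    z + y  ∎

  +-mono-≤ : ∀ {a b c d} → a ≤ b → c ≤ d → a + c ≤ b + d
  +-mono-≤ {b = b} {c} a≤b c≤d = ≤-trans (+-monoˡ-≤ c a≤b) (+-monoʳ-≤ b c≤d)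

  +-nonneg : ∀ {x y} → 0# ≤ x → 0# ≤ y → 0# ≤ x + y
  +-nonneg 0≤x 0≤y = ≤-respˡ-≈ (+-identityˡ 0#) (+-mono-≤ 0≤x 0≤y)

  x+y≈0⇒x≈0 : ∀ {x y} → 0# ≤ x → 0# ≤ y → x + y ≈ 0# → x ≈ 0#
  x+y≈0⇒x≈0 {x} {y} 0≤x 0≤y x+y≈0 = antisym x≤0 0≤x
    where
    x≤0 : x ≤ 0#
    x≤0 = begin
      x      ≈⟨ +-identityʳ x ⟨
      x + 0# ≤⟨ +-monoʳ-≤ x 0≤y ⟩
      x + y  ≈⟨ x+y≈0 ⟩
      0#     ∎

  x≤y⇒0≤y-x : ∀ {x y} → x ≤ y → 0# ≤ y - x
  x≤y⇒0≤y-x {x} x≤y = ≤-respˡ-≈ (-‿inverseʳ x) (+-monoˡ-≤ (- x) x≤y)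

  0≤y-x⇒x≤y : ∀ {x y} → 0# ≤ y - x → x ≤ y
  0≤y-x⇒x≤y {x} {y} 0≤y-x = begin
    x            ≈⟨ +-identityˡ x ⟨
    0# + x       ≤⟨ +-monoˡ-≤ x 0≤y-x ⟩
    (y - x) + x  ≈⟨ //-rightDividesˡ x y ⟩
    y            ∎

  0≤1 : 0# ≤ 1#
  0≤1 with total 0# 1#
  ... | inj₁ 0≤1 = 0≤1
  ... | inj₂ 1≤0 = ≤-respʳ-≈ -1*-1≈1 (*-nonneg 0≤-1 0≤-1)
    where
    0≤-1 : 0# ≤ - 1#
    0≤-1 = ≤-respʳ-≈ (+-identityˡ (- 1#)) (x≤y⇒0≤y-x 1≤0)
    -1*-1≈1 : - 1# * - 1# ≈ 1#
    -1*-1≈1 = ≈-trans (-1*x≈-x (- 1#)) (⁻¹-involutive 1#)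

  *-monoˡ-≤-nonneg : ∀ {x y z} → 0# ≤ z → x ≤ y → x * z ≤ y * z
  *-monoˡ-≤-nonneg {x} {y} {z} 0≤z x≤y =
    0≤y-x⇒x≤y (≤-respʳ-≈ ([y-z]x≈yx-zx z y x) (*-nonneg (x≤y⇒0≤y-x x≤y) 0≤z))

  ⁻¹-nonneg : ∀ {x} → 0# ≤ x → ¬ (x ≈ 0#) → 0# ≤ x ⁻¹
  ⁻¹-nonneg {x} 0≤x x≉0 with total 0# (x ⁻¹)
  ... | inj₁ 0≤x⁻¹ = 0≤x⁻¹
  ... | inj₂ x⁻¹≤0 = ⊥-elim (0≉1 (≈-sym (antisym 1≤0 0≤1)))
    where
    1≤0 : 1# ≤ 0#
    1≤0 = begin
      1#          ≈⟨ ⁻¹-inverse x x≉0 ⟨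
      x * x ⁻¹    ≈⟨ *-comm x (x ⁻¹) ⟩
      x ⁻¹ * x    ≤⟨ *-monoˡ-≤-nonneg 0≤x x⁻¹≤0 ⟩
      0# * x      ≈⟨ zeroˡ x ⟩
      0#          ∎

  fromℕ-nonneg : ∀ m → 0# ≤ fromℕ m
  fromℕ-nonneg zero    = ≤-refl
  fromℕ-nonneg (suc m) = +-nonneg 0≤1 (fromℕ-nonneg m)

  fromℕ-suc≉0 : ∀ m → ¬ (fromℕ (suc m) ≈ 0#)
  fromℕ-suc≉0 m 1+m≈0 = 0≉1 (≈-sym (x+y≈0⇒x≈0 0≤1 (fromℕ-nonneg m) 1+m≈0))

  k*x≤y⇒x/y≤1/k : ∀ {x y k} → 0# ≤ k → ¬ (k ≈ 0#) → 0# < y → k * x ≤ y → x / y ≤ 1# / k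
  k*x≤y⇒x/y≤1/k {x} {y} {k} 0≤k k≉0 (0≤y , 0≉y) kx≤y = begin
    x * y ⁻¹                  ≈⟨ *-identityʳ (x * y ⁻¹) ⟨
    (x * y ⁻¹) * 1#           ≈⟨ *-cong ≈-refl (⁻¹-inverse k k≉0) ⟨
    (x * y ⁻¹) * (k * k ⁻¹)   ≈⟨ interchange x (y ⁻¹) k (k ⁻¹) ⟩
    (x * k) * (y ⁻¹ * k ⁻¹)   ≈⟨ *-cong (*-comm x k) ≈-refl ⟩
    (k * x) * (y ⁻¹ * k ⁻¹)   ≤⟨ *-monoˡ-≤-nonneg 0≤y⁻¹k⁻¹ kx≤y ⟩
    y * (y ⁻¹ * k ⁻¹)         ≈⟨ *-assoc y (y ⁻¹) (k ⁻¹) ⟨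
    (y * y ⁻¹) * k ⁻¹         ≈⟨ *-cong (⁻¹-inverse y y≉0) ≈-refl ⟩
    1# * k ⁻¹                 ∎
    where
    y≉0 : ¬ (y ≈ 0#)
    y≉0 y≈0 = 0≉y (≈-sym y≈0)
    0≤y⁻¹k⁻¹ : 0# ≤ y ⁻¹ * k ⁻¹
    0≤y⁻¹k⁻¹ = *-nonneg (⁻¹-nonneg 0≤y y≉0) (⁻¹-nonneg 0≤k k≉0)

module SumProperties (R : RealField) where
  open RealOps R
  open OrderedFieldProperties R
  open IsTotalOrder isTotalOrder using (≤-respʳ-≈) renaming (refl to ≤-refl)
  open PosetReasoning poset

  ∑<-n≡∑ : ∀ {n} (f : Fin n → Carrier) → ∑< n f ≡ ∑ f
  ∑<-n≡∑ {zero}  f = ≡.refl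
  ∑<-n≡∑ {suc n} f = ≡.cong (f fzero +_) (∑<-n≡∑ (λ i → f (fsuc i)))

  ∑<-nonneg : ∀ {n} k {f : Fin n → Carrier} → (∀ i → 0# ≤ f i) → 0# ≤ ∑< k f
  ∑<-nonneg {zero}  k       _   = ≤-refl
  ∑<-nonneg {suc n} zero    _   = ≤-refl
  ∑<-nonneg {suc n} (suc k) f≥0 = +-nonneg (f≥0 fzero) (∑<-nonneg k (λ i → f≥0 (fsuc i)))

  ∑<≤∑ : ∀ {n} k {f : Fin n → Carrier} → (∀ i → 0# ≤ f i) → ∑< k f ≤ ∑ f
  ∑<≤∑ {zero}  k       _   = ≤-refl
  ∑<≤∑ {suc n} zero {f} f≥0 = ≤-respʳ-≈ (≈-reflexive (∑<-n≡∑ f)) (∑<-nonneg (suc n) f≥0)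
  ∑<≤∑ {suc n} (suc k) {f} f≥0 = +-monoʳ-≤ (f fzero) (∑<≤∑ k (λ i → f≥0 (fsuc i)))

  ∑<≈0⇒≈0 : ∀ {n} k {f : Fin n → Carrier} → (∀ i → 0# ≤ f i) → ∑< k f ≈ 0# →
            ∀ i → toℕ i <ℕ k → f i ≈ 0#
  ∑<≈0⇒≈0 {suc n} (suc k) f≥0 ∑≈0 fzero _ =
    x+y≈0⇒x≈0 (f≥0 fzero) (∑<-nonneg k (λ i → f≥0 (fsuc i))) ∑≈0
  ∑<≈0⇒≈0 {suc n} (suc k) {f} f≥0 ∑≈0 (fsuc i) (s≤s i<k) =
    ∑<≈0⇒≈0 k (λ i → f≥0 (fsuc i)) tail≈0 i i<k
    where
    tail≈0 : ∑< k (λ i → f (fsuc i)) ≈ 0#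
    tail≈0 = x+y≈0⇒x≈0 (∑<-nonneg k (λ i → f≥0 (fsuc i))) (f≥0 fzero) (≈-trans (+-comm _ _) ∑≈0)

  ∑<-const : ∀ {n} k {f : Fin n → Carrier} {c} → k ≤ℕ n → (∀ i → toℕ i <ℕ k → f i ≈ c) →
             ∑< k f ≈ fromℕ k * c
  ∑<-const {zero}  zero {c = c} _ _ = ≈-sym (zeroˡ c)
  ∑<-const {suc n} zero {c = c} _ _ = ≈-sym (zeroˡ c)
  ∑<-const {suc n} (suc k) {f} {c} (s≤s k≤n) f≈c = begin-equality
    f fzero + ∑< k (λ i → f (fsuc i))  ≈⟨ +-cong (f≈c fzero (s≤s z≤n))
                                                  (∑<-const k k≤n (λ i i<k → f≈c (fsuc i) (s≤s i<k))) ⟩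
    c + fromℕ k * c                    ≈⟨ +-cong (*-identityˡ c) ≈-refl ⟨
    1# * c + fromℕ k * c               ≈⟨ distribʳ c 1# (fromℕ k) ⟨
    fromℕ (suc k) * c                  ∎

module DistanceSums (R : RealField) {V : Set} {dist : V → V → RealField.Carrier R}
  (isQuasiSemiMetric : IsQuasiSemiMetric _≡_ (RealField._≈_ R) (RealField._≤_ R) (RealField.0# R) dist)
  {n : ℕ} (p : Fin n → V) where

  open RealOps R
  open OrderedFieldProperties R
  open SumProperties R
  open IsQuasiSemiMetric isQuasiSemiMetric using (nonNegative; 0⇒≈)
  open PosetReasoning poset

  Q≈0⇒dist≈0 : ∀ k → Q dist p k ≈ 0# → ∀ {i j} → toℕ i <ℕ k → toℕ j <ℕ k → dist (p i) (p j) ≈ 0#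
  Q≈0⇒dist≈0 k Qk≈0 {i} i<k j<k = ∑<≈0⇒≈0 k (λ _ → nonNegative) rowᵢ≈0 _ j<k
    where
    rowᵢ≈0 : ∑< k (λ j → dist (p i) (p j)) ≈ 0#
    rowᵢ≈0 = ∑<≈0⇒≈0 k (λ i → ∑<-nonneg k (λ j → nonNegative {p i} {p j})) Qk≈0 i i<k

  Q≈0⇒≡ : ∀ k → Q dist p k ≈ 0# → ∀ {i j} → toℕ i <ℕ k → toℕ j <ℕ k → p i ≡ p j
  Q≈0⇒≡ k Qk≈0 i<k j<k = 0⇒≈ (Q≈0⇒dist≈0 k Qk≈0 i<k j<k)

  Q≈0⇒k*∑dist≤Qn : ∀ k t → k ≤ℕ n → toℕ t <ℕ k → Q dist p k ≈ 0# →
                   fromℕ k * ∑ (λ i → dist (p t) (p i)) ≤ Q dist p n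
  Q≈0⇒k*∑dist≤Qn k t k≤n t<k Qk≈0 = begin
    fromℕ k * ∑ (λ j → dist (p t) (p j))  ≈⟨ ∑<-const k k≤n row≈row-t ⟨
    ∑< k row                              ≤⟨ ∑<≤∑ k row≥0 ⟩
    ∑ row                                 ≡⟨ ∑<-n≡∑ row ⟨
    Q dist p n                            ∎
    where
    row : Fin n → Carrier
    row i = ∑< n (λ j → dist (p i) (p j))
    row≥0 : ∀ i → 0# ≤ row i
    row≥0 i = ∑<-nonneg n (λ j → nonNegative {p i} {p j})
    row≈row-t : ∀ i → toℕ i <ℕ k → row i ≈ ∑ (λ j → dist (p t) (p j))
    row≈row-t i i<k = ≈-reflexive (≡.trans (∑<-n≡∑ (λ j → dist (p i) (p j)))
                                           (≡.cong (λ x → ∑ (λ j → dist x (p j))) (Q≈0⇒≡ k Qk≈0 i<k t<k)))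

lemma3p6 : (R : RealField) → let open RealOps R in
    {V : Set} (dist : V → V → Carrier) →
    IsGeneralMetric _≡_ _≈_ _≤_ 0# _+_ dist →
    (n : ℕ) (p : Fin n → V) →
    0# < Q dist p n →
    (t : Fin n) →
    Q dist p (suc (toℕ t)) ≈ 0# →
    ∑ (λ i → dist (p t) (p i)) / Q dist p n ≤ 1# / fromℕ (suc (toℕ t))
lemma3p6 R dist isMetric n p 0<Qn t Qt≈0 =
  k*x≤y⇒x/y≤1/k (fromℕ-nonneg (suc (toℕ t))) (fromℕ-suc≉0 (toℕ t)) 0<Qn
    (Q≈0⇒k*∑dist≤Qn (suc (toℕ t)) t (toℕ<n t) (n<1+n (toℕ t)) Qt≈0)
  where
  open OrderedFieldProperties R
  open DistanceSums R (IsGeneralMetric.isQuasiSemiMetric isMetric) p
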